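{- Let $k,r,h,s$ be integers with $k\geq 1$, $r\geq 1$, $h\geq 0$, $s\geq 1$. If $h>(r-1)s$, then \[\sum_{i\geq 0}(-1)^iq^{rk(i^2-i)/2}{{s}\brack {i}}_{rk}{{h-ri+s-1}\brack {s-1}}_{k}=0.\]
   Context: $(x;q)_0=1$, $(x;q)_n=(1-x)\cdots(1-xq^{n-1})$. For a positive integer $k$ and integers $A,B$, ${A\brack B}_k=\frac{(q^k;q^k)_A}{(q^k;q^k)_B(q^k;q^k)_{A-B}}$ if $A\geq B\geq 0$, and $0$ otherwise. -}

module Defs where

-- Formal power series in q with integer coefficients, ℤ[[q]],
-- represented by their coefficient functions.  All objects in the
-- statement are polynomials in q, so an identity in ℤ[[q]] is exactly
-- the polynomial identity of the paper.

open import Data.Nat using (ℕ; zero; suc; _∸_; _≤?_)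
open import Data.Nat.Properties using (_≟_)
open import Data.Integer using (ℤ; +_; -[1+_]; 0ℤ; 1ℤ; _+_; _*_; -_)
open import Relation.Nullary using (yes; no)

Series : Set
Series = ℕ → ℤ

sumTo : ℕ → (ℕ → ℤ) → ℤ
sumTo zero f = f 0
sumTo (suc n) f = sumTo n f + f (suc n)

mono : ℕ → Series
mono m n with n ≟ m
... | yes _ = 1ℤ
... | no _ = 0ℤ

oneS : Series
oneS = mono 0

zeroS : Series
zeroS _ = 0ℤ

_⊕_ : Series → Series → Series
(f ⊕ g) n = f n + g n

_⊖_ : Series → Series → Series
(f ⊖ g) n = f n + - g n

_·S_ : ℤ → Series → Series
(c ·S f) n = c * f n

_⊛_ : Series → Series → Series
(f ⊛ g) n = sumTo n (λ j → f j * g (n ∸ j))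

infixl 7 _⊛_ _·S_
infixl 6 _⊕_ _⊖_

powS : Series → ℕ → Series
powS f zero = oneS
powS f (suc n) = powS f n ⊛ f

qPoch : Series → Series → ℕ → Series
qPoch x q zero = oneS
qPoch x q (suc n) = qPoch x q n ⊛ (oneS ⊖ x ⊛ powS q n)

-- Multiplicative inverse in ℤ[[q]] of a series with constant term 1:
-- b_0 = 1, b_{n+1} = - Σ_{j=1}^{n+1} f_j b_{n+1-j}.
-- invApprox f n computes the coefficients b_0..b_n.
invApprox : Series → ℕ → Series
invApprox f zero m = mono 0 m
invApprox f (suc n) m with m ≟ suc n
... | yes _ = - sumTo n (λ j → f (suc j) * invApprox f n (n ∸ j))
... | no _ = invApprox f n m

invS : Series → Series
invS f n = invApprox f n n

-- Gaussian binomial [A brack B]_k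
--   = (q^k;q^k)_A / ((q^k;q^k)_B (q^k;q^k)_{A-B})  if A ≥ B ≥ 0, and 0 otherwise.
-- The denominators have constant term 1, so the quotient is taken in ℤ[[q]].
qbin : ℕ → ℤ → ℤ → Series
qbin k (+ a) (+ b) with b ≤? a
... | yes _ = qPoch (mono k) (mono k) a
                ⊛ invS (qPoch (mono k) (mono k) b)
                ⊛ invS (qPoch (mono k) (mono k) (a ∸ b))
... | no _ = zeroS
qbin k (+ a) -[1+ b ] = zeroS
qbin k -[1+ a ] B = zeroS

negOnePow : ℕ → ℤ
negOnePow zero = 1ℤ
negOnePow (suc n) = - negOnePow n

{-# OPTIONS --safe #-}
module Submission where

-- Write L_t(h) for the left-hand side with  s = t + 1 .  As a generating function in  x ,
--   Σ_h L_t(h) x^h = (x^r ; q^{rk})_s / (x ; q^k)_s = ∏_{j<s} (1 + y_j + ⋯ + y_j^{r-1}),  y_j = x q^{kj},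
-- a polynomial of degree (r-1)s.  Coefficientwise, the two q-Pascal rules give
--   L_{t+1}(h) - q^{k(t+1)} L_{t+1}(h-1) = L_t(h) - q^{rk(t+1)} L_t(h-r),
-- which, as all L_t vanish for h < 0, forces  L_{t+1}(h) = Σ_{j<r} q^{k(t+1)j} L_t(h-j) .
-- Since  L_0(h) = [h ≥ 0] - [h ≥ r] , induction on t gives  L_t(h) = 0  for  h > (r-1)(t+1) .
-- Gaussian binomials are handled through  [b+c, b]_K (q^K;q^K)_b (q^K;q^K)_c = (q^K;q^K)_{b+c}  and
-- cancellation of series with constant term 1.

open import Defs
open import Data.Nat using (ℕ; _≤_; _<_; _*_; _∸_; _/_)
open import Data.Integer using (+_; 0ℤ; 1ℤ; _-_; _+_)
open import Relation.Binary.PropositionalEquality using (_≡_)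

open import Data.Nat using (zero; suc; z≤n; s≤s; _≤?_) renaming (_+_ to _+ℕ_)
import Data.Nat.Properties as ℕ
open import Data.Nat.DivMod using (/-congˡ; +-distrib-/-∣ʳ; m*n/n≡m)
open import Data.Nat.Divisibility using (divides)
open import Data.Nat.Tactic.RingSolver using () renaming (solve-∀ to ℕ-solve-∀)
open import Data.Integer using (ℤ; -_; -[1+_]; -1ℤ) renaming (_*_ to _*ℤ_; _<_ to _<ℤ_)
open import Data.Integer.Base using (+<+; -<+)
import Data.Integer.Properties as ℤ
open import Data.Integer.Tactic.RingSolver using () renaming (solve-∀ to ℤ-solve-∀)
open import Data.Product using (_,_)
open import Data.Sum using (inj₁; inj₂)
open import Data.Maybe using (Maybe; just; nothing)
open import Relation.Nullary using (yes; no; contradiction)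
open import Relation.Binary.PropositionalEquality
  using (refl; sym; trans; cong; cong₂; subst; _≢_; module ≡-Reasoning)
import Relation.Binary.Reasoning.Setoid
open import Algebra.Bundles using (CommutativeRing)
open import Algebra.Properties.CommutativeSemigroup ℤ.+-commutativeSemigroup using (interchange)
open import Algebra.Solver.Ring.AlmostCommutativeRing
  using (fromCommutativeRing; _-Raw-AlmostCommutative⟶_)

-- Finite sums of integers

sumTo-cong-≤ : ∀ n {f g : ℕ → ℤ} → (∀ j → j ≤ n → f j ≡ g j) → sumTo n f ≡ sumTo n g
sumTo-cong-≤ zero f≡g = f≡g 0 z≤n
sumTo-cong-≤ (suc n) f≡g =
  cong₂ _+_ (sumTo-cong-≤ n (λ j j≤n → f≡g j (ℕ.m≤n⇒m≤1+n j≤n))) (f≡g (suc n) ℕ.≤-refl)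

sumTo-cong : ∀ n {f g : ℕ → ℤ} → (∀ j → f j ≡ g j) → sumTo n f ≡ sumTo n g
sumTo-cong n f≡g = sumTo-cong-≤ n (λ j _ → f≡g j)

sumTo-0 : ∀ n → sumTo n (λ _ → 0ℤ) ≡ 0ℤ
sumTo-0 zero = refl
sumTo-0 (suc n) = cong (_+ 0ℤ) (sumTo-0 n)

sumTo-distrib-+ : ∀ n (f g : ℕ → ℤ) → sumTo n (λ j → f j + g j) ≡ sumTo n f + sumTo n g
sumTo-distrib-+ zero f g = refl
sumTo-distrib-+ (suc n) f g =
  trans (cong (_+ (f (suc n) + g (suc n))) (sumTo-distrib-+ n f g))
        (interchange (sumTo n f) (sumTo n g) (f (suc n)) (g (suc n)))

sumTo-*ˡ : ∀ n c (f : ℕ → ℤ) → c *ℤ sumTo n f ≡ sumTo n (λ j → c *ℤ f j)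
sumTo-*ˡ zero c f = refl
sumTo-*ˡ (suc n) c f =
  trans (ℤ.*-distribˡ-+ c (sumTo n f) (f (suc n))) (cong (_+ c *ℤ f (suc n)) (sumTo-*ˡ n c f))

sumTo-*ʳ : ∀ n c (f : ℕ → ℤ) → sumTo n f *ℤ c ≡ sumTo n (λ j → f j *ℤ c)
sumTo-*ʳ n c f =
  trans (ℤ.*-comm (sumTo n f) c) (trans (sumTo-*ˡ n c f) (sumTo-cong n (λ j → ℤ.*-comm c (f j))))

sumTo-neg : ∀ n (f : ℕ → ℤ) → - sumTo n f ≡ sumTo n (λ j → - f j)
sumTo-neg zero f = refl
sumTo-neg (suc n) f =
  trans (ℤ.neg-distrib-+ (sumTo n f) (f (suc n))) (cong (_+ - f (suc n)) (sumTo-neg n f))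

sumTo-zero : ∀ n {f : ℕ → ℤ} → (∀ j → j ≤ n → f j ≡ 0ℤ) → sumTo n f ≡ 0ℤ
sumTo-zero n f≡0 = trans (sumTo-cong-≤ n f≡0) (sumTo-0 n)

sumTo-suc : ∀ n (f : ℕ → ℤ) → sumTo (suc n) f ≡ f 0 + sumTo n (λ j → f (suc j))
sumTo-suc zero f = refl
sumTo-suc (suc n) f =
  trans (cong (_+ f (suc (suc n))) (sumTo-suc n f)) (ℤ.+-assoc (f 0) _ _)

sumTo-reverse : ∀ n (f : ℕ → ℤ) → sumTo n f ≡ sumTo n (λ j → f (n ∸ j))
sumTo-reverse zero f = refl
sumTo-reverse (suc n) f = begin
  sumTo n f + f (suc n)                              ≡⟨ cong (_+ f (suc n)) (sumTo-reverse n f) ⟩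
  sumTo n (λ j → f (n ∸ j)) + f (suc n)              ≡⟨ ℤ.+-comm _ (f (suc n)) ⟩
  f (suc n) + sumTo n (λ j → f (suc n ∸ suc j))      ≡⟨ sym (sumTo-suc n (λ j → f (suc n ∸ j))) ⟩
  sumTo (suc n) (λ j → f (suc n ∸ j))                ∎
  where open ≡-Reasoning

sumTo-single : ∀ n a (f : ℕ → ℤ) → a ≤ n → (∀ j → j ≢ a → f j ≡ 0ℤ) → sumTo n f ≡ f a
sumTo-single zero .zero f z≤n f≡0 = refl
sumTo-single (suc n) a f a≤1+n f≡0 with ℕ.m≤n⇒m<n∨m≡n a≤1+n
... | inj₁ (s≤s a≤n) =
  trans (cong₂ _+_ (sumTo-single n a f a≤n f≡0) (f≡0 (suc n) (ℕ.>⇒≢ (s≤s a≤n))))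
        (ℤ.+-identityʳ (f a))
... | inj₂ refl =
  trans (cong (_+ f (suc n)) (sumTo-zero n (λ j j≤n → f≡0 j (ℕ.<⇒≢ (s≤s j≤n)))))
        (ℤ.+-identityˡ (f (suc n)))

-- Both sides sum  g(j, m)  over  0 ≤ j ≤ m ≤ n , reindexed by  m = j + i .
sumTo-triangle : ∀ n (g : ℕ → ℕ → ℤ) →
  sumTo n (λ m → sumTo m (λ j → g j m)) ≡ sumTo n (λ j → sumTo (n ∸ j) (λ i → g j (j +ℕ i)))
sumTo-triangle zero g = refl
sumTo-triangle (suc n) g = begin
    sumTo n (λ m → sumTo m (λ j → g j m)) + (sumTo n (λ j → g j (suc n)) + g (suc n) (suc n))
  ≡⟨ cong (_+ (sumTo n (λ j → g j (suc n)) + g (suc n) (suc n))) (sumTo-triangle n g) ⟩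
    S n + (sumTo n (λ j → g j (suc n)) + g (suc n) (suc n))
  ≡⟨ sym (ℤ.+-assoc (S n) _ _) ⟩
    (S n + sumTo n (λ j → g j (suc n))) + g (suc n) (suc n)
  ≡⟨ cong₂ _+_ (sym (sumTo-distrib-+ n _ _)) (cong (g (suc n)) (sym (ℕ.+-identityʳ (suc n)))) ⟩
    sumTo n (λ j → sumTo (n ∸ j) (λ i → g j (j +ℕ i)) + g j (suc n)) + g (suc n) (suc n +ℕ 0)
  ≡⟨ cong₂ _+_ (sumTo-cong-≤ n (λ j j≤n → sym (row-suc j j≤n)))
               (cong (λ m → sumTo m (λ i → g (suc n) (suc n +ℕ i))) (sym (ℕ.n∸n≡0 n))) ⟩
    sumTo n (λ j → sumTo (suc n ∸ j) (λ i → g j (j +ℕ i)))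
      + sumTo (suc n ∸ suc n) (λ i → g (suc n) (suc n +ℕ i))
  ∎
  where
  open ≡-Reasoning
  S : ℕ → ℤ
  S n = sumTo n (λ j → sumTo (n ∸ j) (λ i → g j (j +ℕ i)))
  row-suc : ∀ j → j ≤ n →
    sumTo (suc n ∸ j) (λ i → g j (j +ℕ i)) ≡ sumTo (n ∸ j) (λ i → g j (j +ℕ i)) + g j (suc n)
  row-suc j j≤n rewrite ℕ.+-∸-assoc 1 j≤n =
    cong (λ x → sumTo (n ∸ j) (λ i → g j (j +ℕ i)) + x)
         (cong (g j) (trans (ℕ.+-suc j (n ∸ j)) (cong suc (ℕ.m+[n∸m]≡n j≤n))))

-- The ring ℤ[[q]]

mono-≡ : ∀ m → mono m m ≡ 1ℤ
mono-≡ m with m ℕ.≟ m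
... | yes _ = refl
... | no m≢m = contradiction refl m≢m

mono-≢ : ∀ {m n} → n ≢ m → mono m n ≡ 0ℤ
mono-≢ {m} {n} n≢m with n ℕ.≟ m
... | yes n≡m = contradiction n≡m n≢m
... | no _ = refl

mono-respects : ∀ {m n m′ n′} → (n ≡ m → n′ ≡ m′) → (n′ ≡ m′ → n ≡ m) → mono m n ≡ mono m′ n′
mono-respects {m} {n} {m′} {n′} ⇒ ⇐ with n ℕ.≟ m | n′ ℕ.≟ m′
... | yes _ | yes _ = refl
... | no _ | no _ = refl
... | yes n≡m | no n′≢m′ = contradiction (⇒ n≡m) n′≢m′
... | no n≢m | yes n′≡m′ = contradiction (⇐ n′≡m′) n≢m

mono-⊛-≤ : ∀ {a n} f → a ≤ n → (mono a ⊛ f) n ≡ f (n ∸ a)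
mono-⊛-≤ {a} {n} f a≤n =
  trans (sumTo-single n a _ a≤n (λ j j≢a → cong (_*ℤ f (n ∸ j)) (mono-≢ j≢a)))
        (trans (cong (_*ℤ f (n ∸ a)) (mono-≡ a)) (ℤ.*-identityˡ (f (n ∸ a))))

mono-⊛-> : ∀ {a n} f → n < a → (mono a ⊛ f) n ≡ 0ℤ
mono-⊛-> {a} {n} f n<a = sumTo-zero n (λ j j≤n →
  cong (_*ℤ f (n ∸ j)) (mono-≢ (λ j≡a → ℕ.<⇒≱ n<a (ℕ.≤-trans (ℕ.≤-reflexive (sym j≡a)) j≤n))))

-- Coefficientwise equality; the record wrapper lets Agda infer the compared series.
infix 4 _≈_
record _≈_ (f g : Series) : Set where
  constructor coeffwise
  field coeff : ∀ n → f n ≡ g n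
open _≈_ public

negS : Series → Series
negS f n = - f n

⊛-cong : ∀ {f f′ g g′} → f ≈ f′ → g ≈ g′ → f ⊛ g ≈ f′ ⊛ g′
⊛-cong f≈f′ g≈g′ =
  coeffwise (λ n → sumTo-cong n (λ j → cong₂ _*ℤ_ (coeff f≈f′ j) (coeff g≈g′ (n ∸ j))))

⊛-comm : ∀ f g → f ⊛ g ≈ g ⊛ f
⊛-comm f g = coeffwise (λ n → trans (sumTo-reverse n _) (sumTo-cong-≤ n (λ j j≤n →
  trans (cong (λ m → f (n ∸ j) *ℤ g m) (ℕ.m∸[m∸n]≡n j≤n)) (ℤ.*-comm (f (n ∸ j)) (g j)))))

⊛-assoc : ∀ f g h → (f ⊛ g) ⊛ h ≈ f ⊛ (g ⊛ h)
⊛-assoc f g h = coeffwise λ n → begin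
    sumTo n (λ m → sumTo m (λ j → f j *ℤ g (m ∸ j)) *ℤ h (n ∸ m))
  ≡⟨ sumTo-cong n (λ m → sumTo-*ʳ m (h (n ∸ m)) (λ j → f j *ℤ g (m ∸ j))) ⟩
    sumTo n (λ m → sumTo m (λ j → f j *ℤ g (m ∸ j) *ℤ h (n ∸ m)))
  ≡⟨ sumTo-triangle n (λ j m → f j *ℤ g (m ∸ j) *ℤ h (n ∸ m)) ⟩
    sumTo n (λ j → sumTo (n ∸ j) (λ i → f j *ℤ g (j +ℕ i ∸ j) *ℤ h (n ∸ (j +ℕ i))))
  ≡⟨ sumTo-cong n (λ j → sumTo-cong (n ∸ j) (λ i →
       trans (cong₂ (λ a b → f j *ℤ g a *ℤ h b) (ℕ.m+n∸m≡n j i) (sym (ℕ.∸-+-assoc n j i)))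
             (ℤ.*-assoc (f j) (g i) (h (n ∸ j ∸ i))))) ⟩
    sumTo n (λ j → sumTo (n ∸ j) (λ i → f j *ℤ (g i *ℤ h (n ∸ j ∸ i))))
  ≡⟨ sumTo-cong n (λ j → sym (sumTo-*ˡ (n ∸ j) (f j) (λ i → g i *ℤ h (n ∸ j ∸ i)))) ⟩
    sumTo n (λ j → f j *ℤ sumTo (n ∸ j) (λ i → g i *ℤ h (n ∸ j ∸ i)))
  ∎
  where open ≡-Reasoning

⊛-distribʳ : ∀ f g h → (g ⊕ h) ⊛ f ≈ (g ⊛ f) ⊕ (h ⊛ f)
⊛-distribʳ f g h = coeffwise (λ n →
  trans (sumTo-cong n (λ j → ℤ.*-distribʳ-+ (f (n ∸ j)) (g j) (h j))) (sumTo-distrib-+ n _ _))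

⊛-distribˡ : ∀ f g h → f ⊛ (g ⊕ h) ≈ (f ⊛ g) ⊕ (f ⊛ h)
⊛-distribˡ f g h = coeffwise (λ n →
  trans (sumTo-cong n (λ j → ℤ.*-distribˡ-+ (f j) (g (n ∸ j)) (h (n ∸ j)))) (sumTo-distrib-+ n _ _))

⊛-identityˡ : ∀ f → oneS ⊛ f ≈ f
⊛-identityˡ f = coeffwise (λ n → mono-⊛-≤ f z≤n)

⊛-identityʳ : ∀ f → f ⊛ oneS ≈ f
⊛-identityʳ f = coeffwise (λ n → trans (coeff (⊛-comm f oneS) n) (mono-⊛-≤ f z≤n))

ℤ[[q]] : CommutativeRing _ _
ℤ[[q]] = record
  { Carrier = Series
  ; _≈_ = _≈_
  ; _+_ = _⊕_
  ; _*_ = _⊛_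
  ; -_ = negS
  ; 0# = zeroS
  ; 1# = oneS
  ; isCommutativeRing = record
    { isRing = record
      { +-isAbelianGroup = record
        { isGroup = record
          { isMonoid = record
            { isSemigroup = record
              { isMagma = record
                { isEquivalence = record
                  { refl = coeffwise (λ _ → refl)
                  ; sym = λ f≈g → coeffwise (λ n → sym (coeff f≈g n))
                  ; trans = λ f≈g g≈h → coeffwise (λ n → trans (coeff f≈g n) (coeff g≈h n)) }
                ; ∙-cong = λ f≈f′ g≈g′ → coeffwise (λ n → cong₂ _+_ (coeff f≈f′ n) (coeff g≈g′ n)) }
              ; assoc = λ f g h → coeffwise (λ n → ℤ.+-assoc (f n) (g n) (h n)) }
            ; identity = (λ f → coeffwise (λ n → ℤ.+-identityˡ (f n)))
                       , (λ f → coeffwise (λ n → ℤ.+-identityʳ (f n))) }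
          ; inverse = (λ f → coeffwise (λ n → ℤ.+-inverseˡ (f n)))
                    , (λ f → coeffwise (λ n → ℤ.+-inverseʳ (f n)))
          ; ⁻¹-cong = λ f≈g → coeffwise (λ n → cong -_ (coeff f≈g n)) }
        ; comm = λ f g → coeffwise (λ n → ℤ.+-comm (f n) (g n)) }
      ; *-cong = ⊛-cong
      ; *-assoc = ⊛-assoc
      ; *-identity = ⊛-identityˡ , ⊛-identityʳ
      ; distrib = ⊛-distribˡ , ⊛-distribʳ }
    ; *-comm = ⊛-comm } }

·S-⊛ : ∀ c f g → (c ·S f) ⊛ g ≈ c ·S (f ⊛ g)
·S-⊛ c f g = coeffwise (λ n →
  trans (sumTo-cong n (λ j → ℤ.*-assoc c (f j) (g (n ∸ j)))) (sym (sumTo-*ˡ n c _)))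

-- Integer constants are the coefficients of the ring solver, so that its coefficient arithmetic computes.
constS : ℤ → Series
constS c = c ·S oneS

constS-homomorphism :
  CommutativeRing.rawRing ℤ.+-*-commutativeRing -Raw-AlmostCommutative⟶ fromCommutativeRing ℤ[[q]]
constS-homomorphism = record
  { ⟦_⟧ = constS
  ; +-homo = λ a b → coeffwise (λ n → ℤ.*-distribʳ-+ (oneS n) a b)
  ; *-homo = λ a b → coeffwise (λ n → trans (ℤ.*-assoc a b (oneS n))
      (sym (trans (coeff (·S-⊛ a oneS (constS b)) n) (cong (a *ℤ_) (mono-⊛-≤ (constS b) z≤n)))))
  ; -‿homo = λ a → coeffwise (λ n → sym (ℤ.neg-distribˡ-* a (oneS n)))
  ; 0-homo = coeffwise (λ n → refl)
  ; 1-homo = coeffwise (λ n → ℤ.*-identityˡ (oneS n))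
  }

constS-≟ : ∀ a b → Maybe (constS a ≈ constS b)
constS-≟ a b with a ℤ.≟ b
... | yes refl = just (coeffwise (λ _ → refl))
... | no _ = nothing

open import Algebra.Solver.Ring (CommutativeRing.rawRing ℤ.+-*-commutativeRing)
  (fromCommutativeRing ℤ[[q]]) constS-homomorphism constS-≟
  using (solve; _:+_; _:-_; _:*_; :-_; _:=_; con)
open CommutativeRing ℤ[[q]]
  using (ring; setoid; +-cong; +-congˡ; +-congʳ; *-cong; *-congˡ; *-congʳ; -‿cong;
         *-identityˡ; *-identityʳ; +-identityˡ; +-identityʳ; zeroˡ; zeroʳ; *-comm; *-assoc; distribˡ)
  renaming (refl to ≈-refl; sym to ≈-sym; trans to ≈-trans; reflexive to ≈-reflexive)
open import Algebra.Properties.Ring ring using (x[y-z]≈xy-xz)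
module ≈-Reasoning = Relation.Binary.Reasoning.Setoid setoid

constS-neg : ∀ c → constS (- c) ≈ negS (constS c)
constS-neg = _-Raw-AlmostCommutative⟶_.-‿homo constS-homomorphism

·S-as-⊛ : ∀ c f → c ·S f ≈ constS c ⊛ f
·S-as-⊛ c f = ≈-sym (≈-trans (·S-⊛ c oneS f) (coeffwise (λ n → cong (c *ℤ_) (mono-⊛-≤ f z≤n))))

-- Powers of q and inverses

mono-+ : ∀ a b → mono a ⊛ mono b ≈ mono (a +ℕ b)
mono-+ a b = coeffwise coeff-+
  where
  coeff-+ : ∀ n → (mono a ⊛ mono b) n ≡ mono (a +ℕ b) n
  coeff-+ n with a ℕ.≤? n
  ... | yes a≤n = trans (mono-⊛-≤ (mono b) a≤n) (mono-respects
          (λ n∸a≡b → trans (sym (ℕ.m+[n∸m]≡n a≤n)) (cong (a +ℕ_) n∸a≡b))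
          (λ n≡a+b → trans (cong (_∸ a) n≡a+b) (ℕ.m+n∸m≡n a b)))
  ... | no a≰n = trans (mono-⊛-> (mono b) (ℕ.≰⇒> a≰n))
          (sym (mono-≢ (λ n≡a+b → a≰n (ℕ.≤-trans (ℕ.m≤m+n a b) (ℕ.≤-reflexive (sym n≡a+b))))))

powS-mono : ∀ a n → powS (mono a) n ≈ mono (a * n)
powS-mono a zero = ≈-reflexive (cong mono (sym (ℕ.*-zeroʳ a)))
powS-mono a (suc n) = begin
  powS (mono a) n ⊛ mono a   ≈⟨ *-congʳ {mono a} (powS-mono a n) ⟩
  mono (a * n) ⊛ mono a      ≈⟨ mono-+ (a * n) a ⟩
  mono (a * n +ℕ a)          ≡⟨ cong mono (trans (ℕ.+-comm (a * n) a) (sym (ℕ.*-suc a n))) ⟩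
  mono (a * suc n)           ∎
  where open ≈-Reasoning

invApprox-below : ∀ f n {m} → m ≢ suc n → invApprox f (suc n) m ≡ invApprox f n m
invApprox-below f n {m} m≢1+n with m ℕ.≟ suc n
... | yes m≡1+n = contradiction m≡1+n m≢1+n
... | no _ = refl

invApprox-stable : ∀ f n {m} → m ≤ n → invApprox f n m ≡ invS f m
invApprox-stable f n m≤n with ℕ.m≤n⇒m<n∨m≡n m≤n
... | inj₂ refl = refl
... | inj₁ (s≤s {n = n′} m≤n′) =
  trans (invApprox-below f n′ (ℕ.<⇒≢ (s≤s m≤n′))) (invApprox-stable f n′ m≤n′)

invS-suc : ∀ f n → invS f (suc n) ≡ - sumTo n (λ j → f (suc j) *ℤ invS f (n ∸ j))
invS-suc f n with suc n ℕ.≟ suc n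
... | no 1+n≢1+n = contradiction refl 1+n≢1+n
... | yes _ = cong -_ (sumTo-cong-≤ n (λ j _ →
  cong (f (suc j) *ℤ_) (invApprox-stable f n (ℕ.m∸n≤m n j))))

⊛-invS : ∀ f → f 0 ≡ 1ℤ → f ⊛ invS f ≈ oneS
⊛-invS f f₀≡1 = coeffwise coeff-inverse
  where
  coeff-inverse : ∀ n → (f ⊛ invS f) n ≡ oneS n
  coeff-inverse zero = cong (_*ℤ 1ℤ) f₀≡1
  coeff-inverse (suc n) = begin
      sumTo (suc n) (λ j → f j *ℤ invS f (suc n ∸ j))
    ≡⟨ sumTo-suc n _ ⟩
      f 0 *ℤ invS f (suc n) + S
    ≡⟨ cong₂ (λ x y → x *ℤ y + S) f₀≡1 (invS-suc f n) ⟩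
      1ℤ *ℤ - S + S
    ≡⟨ trans (cong (_+ S) (ℤ.*-identityˡ (- S))) (ℤ.+-inverseˡ S) ⟩
      0ℤ
    ≡⟨ sym (mono-≢ {0} {suc n} (λ ())) ⟩
      oneS (suc n)
    ∎
    where
    open ≡-Reasoning
    S = sumTo n (λ j → f (suc j) *ℤ invS f (n ∸ j))

⊛-cancelʳ : ∀ {g h} f → f 0 ≡ 1ℤ → g ⊛ f ≈ h ⊛ f → g ≈ h
⊛-cancelʳ {g} {h} f f₀≡1 gf≈hf = begin
  g                     ≈⟨ ≈-sym (*-identityʳ g) ⟩
  g ⊛ oneS              ≈⟨ *-congˡ {g} (≈-sym (⊛-invS f f₀≡1)) ⟩
  g ⊛ (f ⊛ invS f)      ≈⟨ ≈-sym (*-assoc g f (invS f)) ⟩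
  (g ⊛ f) ⊛ invS f      ≈⟨ *-congʳ {invS f} gf≈hf ⟩
  (h ⊛ f) ⊛ invS f      ≈⟨ *-assoc h f (invS f) ⟩
  h ⊛ (f ⊛ invS f)      ≈⟨ *-congˡ {h} (⊛-invS f f₀≡1) ⟩
  h ⊛ oneS              ≈⟨ *-identityʳ h ⟩
  h                     ∎
  where open ≈-Reasoning

-- Gaussian binomial coefficients

module GaussianBinomial {K : ℕ} (1≤K : 1 ≤ K) where

  qfac : ℕ → Series
  qfac n = qPoch (mono K) (mono K) n

  qfac-suc : ∀ n → qfac (suc n) ≈ qfac n ⊖ qfac n ⊛ mono (K * suc n)
  qfac-suc n = begin
    qfac n ⊛ (oneS ⊖ mono K ⊛ powS (mono K) n)
      ≈⟨ *-congˡ {qfac n} (+-congˡ {oneS} (-‿cong (*-congˡ {mono K} (powS-mono K n)))) ⟩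
    qfac n ⊛ (oneS ⊖ mono K ⊛ mono (K * n))
      ≈⟨ *-congˡ {qfac n} (+-congˡ {oneS} (-‿cong (mono-+ K (K * n)))) ⟩
    qfac n ⊛ (oneS ⊖ mono (K +ℕ K * n))
      ≈⟨ x[y-z]≈xy-xz (qfac n) oneS (mono (K +ℕ K * n)) ⟩
    qfac n ⊛ oneS ⊖ qfac n ⊛ mono (K +ℕ K * n)
      ≈⟨ +-congʳ (*-identityʳ (qfac n)) ⟩
    qfac n ⊖ qfac n ⊛ mono (K +ℕ K * n)
      ≡⟨ cong (λ e → qfac n ⊖ qfac n ⊛ mono e) (sym (ℕ.*-suc K n)) ⟩
    qfac n ⊖ qfac n ⊛ mono (K * suc n) ∎
    where open ≈-Reasoning

  qfac-constant : ∀ n → qfac n 0 ≡ 1ℤ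
  qfac-constant zero = refl
  qfac-constant (suc n) =
    cong₂ _*ℤ_ (qfac-constant n) (cong (λ x → 1ℤ + - x) (mono-⊛-> (powS (mono K) n) 1≤K))

  qbin-≤ : ∀ {a b} → b ≤ a → qbin K (+ a) (+ b) ≡ qfac a ⊛ invS (qfac b) ⊛ invS (qfac (a ∸ b))
  qbin-≤ {a} {b} b≤a with b ≤? a
  ... | yes _ = refl
  ... | no b≰a = contradiction b≤a b≰a

  qbin-< : ∀ {A b} → A <ℤ + b → qbin K A (+ b) ≈ zeroS
  qbin-< {+ a} {b} (+<+ a<b) with b ≤? a
  ... | yes b≤a = contradiction b≤a (ℕ.<⇒≱ a<b)
  ... | no _ = ≈-refl
  qbin-< { -[1+ a ]} _ = ≈-refl

  qbin-qfac : ∀ b c {n} → b +ℕ c ≡ n → qbin K (+ n) (+ b) ⊛ (qfac b ⊛ qfac c) ≈ qfac n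
  qbin-qfac b c refl = begin
    qbin K (+ (b +ℕ c)) (+ b) ⊛ (qfac b ⊛ qfac c)
      ≡⟨ cong (_⊛ (qfac b ⊛ qfac c)) (qbin-≤ (ℕ.m≤m+n b c)) ⟩
    qfac (b +ℕ c) ⊛ invS (qfac b) ⊛ invS (qfac (b +ℕ c ∸ b)) ⊛ (qfac b ⊛ qfac c)
      ≡⟨ cong (λ d → qfac (b +ℕ c) ⊛ invS (qfac b) ⊛ invS (qfac d) ⊛ (qfac b ⊛ qfac c))
              (ℕ.m+n∸m≡n b c) ⟩
    qfac (b +ℕ c) ⊛ invS (qfac b) ⊛ invS (qfac c) ⊛ (qfac b ⊛ qfac c)
      ≈⟨ solve 5 (λ x ib ic fb fc → x :* ib :* ic :* (fb :* fc) := x :* (fb :* ib) :* (fc :* ic)) ≈-refl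
           (qfac (b +ℕ c)) (invS (qfac b)) (invS (qfac c)) (qfac b) (qfac c) ⟩
    qfac (b +ℕ c) ⊛ (qfac b ⊛ invS (qfac b)) ⊛ (qfac c ⊛ invS (qfac c))
      ≈⟨ *-cong (*-congˡ {qfac (b +ℕ c)} (inverse b)) (inverse c) ⟩
    qfac (b +ℕ c) ⊛ oneS ⊛ oneS
      ≈⟨ ≈-trans (*-identityʳ _) (*-identityʳ _) ⟩
    qfac (b +ℕ c) ∎
    where
    open ≈-Reasoning
    inverse : ∀ m → qfac m ⊛ invS (qfac m) ≈ oneS
    inverse m = ⊛-invS (qfac m) (qfac-constant m)

  qbin-unique : ∀ b c {n X} → b +ℕ c ≡ n → X ⊛ (qfac b ⊛ qfac c) ≈ qfac n → X ≈ qbin K (+ n) (+ b)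
  qbin-unique b c b+c≡n X⊛fac≈fac =
    ⊛-cancelʳ (qfac b ⊛ qfac c) (cong₂ _*ℤ_ (qfac-constant b) (qfac-constant c))
              (≈-trans X⊛fac≈fac (≈-sym (qbin-qfac b c b+c≡n)))

  qbin-lower-zero : ∀ n → qbin K (+ n) (+ 0) ≈ oneS
  qbin-lower-zero n = ≈-sym (qbin-unique 0 n refl
    (≈-trans (*-identityˡ (oneS ⊛ qfac n)) (*-identityˡ (qfac n))))

  qbin-diagonal : ∀ n → qbin K (+ n) (+ n) ≈ oneS
  qbin-diagonal n = ≈-sym (qbin-unique n 0 (ℕ.+-identityʳ n)
    (≈-trans (*-identityˡ (qfac n ⊛ oneS)) (*-identityʳ (qfac n))))

  -- With  n = b + c + 1 , u = q^{K(b+1)}  and  v = q^{K(c+1)} , both Pascal rules reduce to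
  -- (1 - u) + u (1 - v) = 1 - u v = (1 - v) + v (1 - u) .
  private module Pascal (b c : ℕ) where
    n : ℕ
    n = suc (b +ℕ c)

    u v denominator : Series
    u = mono (K * suc b)
    v = mono (K * suc c)
    denominator = qfac (suc b) ⊛ qfac (suc c)

    lower : qbin K (+ n) (+ b) ⊛ denominator ≈ qfac n ⊖ u ⊛ qfac n
    lower = begin
      P ⊛ (qfac (suc b) ⊛ qfac (suc c))
        ≈⟨ *-congˡ {P} (*-congʳ {qfac (suc c)} (qfac-suc b)) ⟩
      P ⊛ ((qfac b ⊖ qfac b ⊛ u) ⊛ qfac (suc c))
        ≈⟨ solve 4 (λ p fb u fc → p :* ((fb :- fb :* u) :* fc) := p :* (fb :* fc) :- u :* (p :* (fb :* fc)))
             ≈-refl P (qfac b) u (qfac (suc c)) ⟩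
      P ⊛ (qfac b ⊛ qfac (suc c)) ⊖ u ⊛ (P ⊛ (qfac b ⊛ qfac (suc c)))
        ≈⟨ +-cong P-qfac (-‿cong (*-congˡ {u} P-qfac)) ⟩
      qfac n ⊖ u ⊛ qfac n ∎
      where
      open ≈-Reasoning
      P : Series
      P = qbin K (+ n) (+ b)
      P-qfac : P ⊛ (qfac b ⊛ qfac (suc c)) ≈ qfac n
      P-qfac = qbin-qfac b (suc c) (ℕ.+-suc b c)

    upper : qbin K (+ n) (+ suc b) ⊛ denominator ≈ qfac n ⊖ v ⊛ qfac n
    upper = begin
      Q ⊛ (qfac (suc b) ⊛ qfac (suc c))
        ≈⟨ *-congˡ {Q} (*-congˡ {qfac (suc b)} (qfac-suc c)) ⟩
      Q ⊛ (qfac (suc b) ⊛ (qfac c ⊖ qfac c ⊛ v))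
        ≈⟨ solve 4 (λ q fb fc v → q :* (fb :* (fc :- fc :* v)) := q :* (fb :* fc) :- v :* (q :* (fb :* fc)))
             ≈-refl Q (qfac (suc b)) (qfac c) v ⟩
      Q ⊛ (qfac (suc b) ⊛ qfac c) ⊖ v ⊛ (Q ⊛ (qfac (suc b) ⊛ qfac c))
        ≈⟨ +-cong Q-qfac (-‿cong (*-congˡ {v} Q-qfac)) ⟩
      qfac n ⊖ v ⊛ qfac n ∎
      where
      open ≈-Reasoning
      Q : Series
      Q = qbin K (+ n) (+ suc b)
      Q-qfac : Q ⊛ (qfac (suc b) ⊛ qfac c) ≈ qfac n
      Q-qfac = qbin-qfac (suc b) c refl

    top : qfac (suc n) ≈ qfac n ⊖ qfac n ⊛ (u ⊛ v)
    top = begin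
      qfac (suc n)                          ≈⟨ qfac-suc n ⟩
      qfac n ⊖ qfac n ⊛ mono (K * suc n)    ≡⟨ cong (λ e → qfac n ⊖ qfac n ⊛ mono e) exponent ⟩
      qfac n ⊖ qfac n ⊛ mono (K * suc b +ℕ K * suc c)
        ≈⟨ +-congˡ {qfac n} (-‿cong (*-congˡ {qfac n} (≈-sym (mono-+ (K * suc b) (K * suc c))))) ⟩
      qfac n ⊖ qfac n ⊛ (u ⊛ v)             ∎
      where
      open ≈-Reasoning
      exponent : K * suc n ≡ K * suc b +ℕ K * suc c
      exponent = trans (cong (λ m → K * suc m) (sym (ℕ.+-suc b c))) (ℕ.*-distribˡ-+ K (suc b) (suc c))

    pascal : ∀ X Y w z →
      X ⊛ denominator ≈ qfac n ⊖ w ⊛ qfac n → Y ⊛ denominator ≈ qfac n ⊖ z ⊛ qfac n →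
      w ⊛ z ≈ u ⊛ v → qbin K (+ suc n) (+ suc b) ≈ X ⊕ w ⊛ Y
    pascal X Y w z X-den Y-den wz≈uv = ≈-sym (qbin-unique (suc b) (suc c) (cong suc (ℕ.+-suc b c)) (begin
      (X ⊕ w ⊛ Y) ⊛ denominator
        ≈⟨ solve 4 (λ x w y d → (x :+ w :* y) :* d := x :* d :+ w :* (y :* d)) ≈-refl X w Y denominator ⟩
      X ⊛ denominator ⊕ w ⊛ (Y ⊛ denominator)
        ≈⟨ +-cong X-den (*-congˡ {w} Y-den) ⟩
      (qfac n ⊖ w ⊛ qfac n) ⊕ w ⊛ (qfac n ⊖ z ⊛ qfac n)
        ≈⟨ solve 3 (λ f w z → (f :- w :* f) :+ w :* (f :- z :* f) := f :- f :* (w :* z)) ≈-refl (qfac n) w z ⟩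
      qfac n ⊖ qfac n ⊛ (w ⊛ z)
        ≈⟨ +-congˡ {qfac n} (-‿cong (*-congˡ {qfac n} wz≈uv)) ⟩
      qfac n ⊖ qfac n ⊛ (u ⊛ v)
        ≈⟨ ≈-sym top ⟩
      qfac (suc n) ∎))
      where open ≈-Reasoning

    pascalˡ : qbin K (+ suc n) (+ suc b) ≈ qbin K (+ n) (+ b) ⊕ u ⊛ qbin K (+ n) (+ suc b)
    pascalˡ = pascal (qbin K (+ n) (+ b)) (qbin K (+ n) (+ suc b)) u v lower upper ≈-refl

    pascalʳ : qbin K (+ suc n) (+ suc b) ≈ qbin K (+ n) (+ suc b) ⊕ v ⊛ qbin K (+ n) (+ b)
    pascalʳ = pascal (qbin K (+ n) (+ suc b)) (qbin K (+ n) (+ b)) v u upper lower (*-comm v u)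

  qbin-pascalˡ : ∀ {b n} → b ≤ n →
    qbin K (+ suc n) (+ suc b) ≈ qbin K (+ n) (+ b) ⊕ mono (K * suc b) ⊛ qbin K (+ n) (+ suc b)
  qbin-pascalˡ {b} b≤n with ℕ.m≤n⇒m<n∨m≡n b≤n
  ... | inj₁ b<n with ℕ.m≤n⇒∃[o]m+o≡n b<n
  ...   | c , refl = Pascal.pascalˡ b c
  qbin-pascalˡ {n = n} _ | inj₂ refl = begin
    qbin K (+ suc n) (+ suc n)
      ≈⟨ qbin-diagonal (suc n) ⟩
    oneS
      ≈⟨ ≈-sym (+-identityʳ oneS) ⟩
    oneS ⊕ zeroS
      ≈⟨ +-cong (≈-sym (qbin-diagonal n)) (≈-sym (zeroʳ (mono (K * suc n)))) ⟩
    qbin K (+ n) (+ n) ⊕ mono (K * suc n) ⊛ zeroS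
      ≈⟨ +-congˡ {qbin K (+ n) (+ n)} (*-congˡ {mono (K * suc n)} (≈-sym (qbin-< (+<+ (ℕ.n<1+n n))))) ⟩
    qbin K (+ n) (+ n) ⊕ mono (K * suc n) ⊛ qbin K (+ n) (+ suc n) ∎
    where open ≈-Reasoning

  qbin-pascalʳ : ∀ {b n} → b ≤ n →
    qbin K (+ suc n) (+ suc b) ≈ qbin K (+ n) (+ suc b) ⊕ mono (K * (n ∸ b)) ⊛ qbin K (+ n) (+ b)
  qbin-pascalʳ {b} b≤n with ℕ.m≤n⇒m<n∨m≡n b≤n
  ... | inj₁ b<n with ℕ.m≤n⇒∃[o]m+o≡n b<n
  ...   | c , refl = ≈-trans (Pascal.pascalʳ b c)
    (+-congˡ {qbin K (+ suc (b +ℕ c)) (+ suc b)} (*-congʳ {qbin K (+ suc (b +ℕ c)) (+ b)}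
      (≈-reflexive (cong (λ e → mono (K * e)) (sym 1+b+c∸b≡1+c)))))
    where
    1+b+c∸b≡1+c : suc (b +ℕ c) ∸ b ≡ suc c
    1+b+c∸b≡1+c = trans (cong (_∸ b) (sym (ℕ.+-suc b c))) (ℕ.m+n∸m≡n b (suc c))
  qbin-pascalʳ {n = n} _ | inj₂ refl = begin
    qbin K (+ suc n) (+ suc n)
      ≈⟨ qbin-diagonal (suc n) ⟩
    oneS
      ≈⟨ ≈-sym (+-identityˡ oneS) ⟩
    zeroS ⊕ oneS
      ≈⟨ +-cong (≈-sym (qbin-< (+<+ (ℕ.n<1+n n))))
                (≈-sym (≈-trans (*-congʳ {oneS} q⁰≈1) (*-identityˡ oneS))) ⟩
    qbin K (+ n) (+ suc n) ⊕ mono (K * (n ∸ n)) ⊛ oneS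
      ≈⟨ +-congˡ {qbin K (+ n) (+ suc n)} (*-congˡ {mono (K * (n ∸ n))} (≈-sym (qbin-diagonal n))) ⟩
    qbin K (+ n) (+ suc n) ⊕ mono (K * (n ∸ n)) ⊛ qbin K (+ n) (+ n) ∎
    where
    open ≈-Reasoning
    q⁰≈1 : mono (K * (n ∸ n)) ≈ oneS
    q⁰≈1 = ≈-reflexive (cong mono (trans (cong (K *_) (ℕ.n∸n≡0 n)) (ℕ.*-zeroʳ K)))

-- Finite sums of series and first-order recurrences

ΣS : ℕ → (ℕ → Series) → Series
ΣS N F n = sumTo N (λ i → F i n)

ΣS-cong : ∀ N {F G : ℕ → Series} → (∀ i → F i ≈ G i) → ΣS N F ≈ ΣS N G
ΣS-cong N F≈G = coeffwise (λ n → sumTo-cong N (λ i → coeff (F≈G i) n))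

ΣS-zero : ∀ N {F : ℕ → Series} → (∀ i → i ≤ N → F i ≈ zeroS) → ΣS N F ≈ zeroS
ΣS-zero N F≈0 = coeffwise (λ n → sumTo-zero N (λ i i≤N → coeff (F≈0 i i≤N) n))

ΣS-suc : ∀ N (F : ℕ → Series) → ΣS (suc N) F ≈ F 0 ⊕ ΣS N (λ i → F (suc i))
ΣS-suc N F = coeffwise (λ n → sumTo-suc N (λ i → F i n))

ΣS-⊖ : ∀ N (F G : ℕ → Series) → ΣS N (λ i → F i ⊖ G i) ≈ ΣS N F ⊖ ΣS N G
ΣS-⊖ N F G = coeffwise (λ n →
  trans (sumTo-distrib-+ N (λ i → F i n) (λ i → - G i n))
        (cong (λ x → sumTo N (λ i → F i n) + x) (sym (sumTo-neg N (λ i → G i n)))))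

ΣS-⊛ˡ : ∀ N c (F : ℕ → Series) → c ⊛ ΣS N F ≈ ΣS N (λ i → c ⊛ F i)
ΣS-⊛ˡ zero c F = ≈-refl
ΣS-⊛ˡ (suc N) c F = ≈-trans (distribˡ c (ΣS N F) (F (suc N))) (+-congʳ (ΣS-⊛ˡ N c F))

ΣS-linear : ∀ N w (F G : ℕ → Series) → ΣS N (λ i → F i ⊖ w ⊛ G i) ≈ ΣS N F ⊖ w ⊛ ΣS N G
ΣS-linear N w F G =
  ≈-trans (ΣS-⊖ N F (λ i → w ⊛ G i)) (+-congˡ {ΣS N F} (-‿cong (≈-sym (ΣS-⊛ˡ N w G))))

ΣS-telescope : ∀ N (F : ℕ → Series) → ΣS N F ⊖ ΣS N (λ i → F (suc i)) ≈ F 0 ⊖ F (suc N)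
ΣS-telescope N F = begin
  ΣS N F ⊖ ΣS N F′
    ≈⟨ solve 3 (λ s s′ x → s :- s′ := (s :+ x) :- s′ :- x) ≈-refl (ΣS N F) (ΣS N F′) (F (suc N)) ⟩
  ΣS (suc N) F ⊖ ΣS N F′ ⊖ F (suc N)
    ≈⟨ +-congʳ (+-congʳ (ΣS-suc N F)) ⟩
  F 0 ⊕ ΣS N F′ ⊖ ΣS N F′ ⊖ F (suc N)
    ≈⟨ solve 3 (λ x s′ y → x :+ s′ :- s′ :- y := x :- y) ≈-refl (F 0) (ΣS N F′) (F (suc N)) ⟩
  F 0 ⊖ F (suc N) ∎
  where
  open ≈-Reasoning
  F′ : ℕ → Series
  F′ i = F (suc i)

-- If  a′  is the coefficient sequence of  (1 - w x) · Σ a_i x^i , pairing it against  X  gives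
-- the  a -sums of  X  and of  X  shifted by one.
ΣS-shifted-difference : ∀ N w (a a′ X : ℕ → Series) →
  a′ 0 ≈ a 0 → (∀ j → a′ (suc j) ≈ a (suc j) ⊖ w ⊛ a j) → a (suc N) ≈ zeroS →
  ΣS (suc N) (λ i → a′ i ⊛ X i) ≈ ΣS N (λ i → a i ⊛ X i) ⊖ w ⊛ ΣS N (λ i → a i ⊛ X (suc i))
ΣS-shifted-difference N w a a′ X a′₀ a′ₛ a-top = begin
  ΣS (suc N) (λ i → a′ i ⊛ X i)
    ≈⟨ ΣS-suc N (λ i → a′ i ⊛ X i) ⟩
  a′ 0 ⊛ X 0 ⊕ ΣS N (λ j → a′ (suc j) ⊛ X (suc j))
    ≈⟨ +-cong (*-congʳ {X 0} a′₀) (ΣS-cong N (λ j → *-congʳ {X (suc j)} (a′ₛ j))) ⟩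
  a 0 ⊛ X 0 ⊕ ΣS N (λ j → (a (suc j) ⊖ w ⊛ a j) ⊛ X (suc j))
    ≈⟨ +-congˡ {a 0 ⊛ X 0} (ΣS-cong N (λ j →
         solve 4 (λ x w y z → (x :- w :* y) :* z := x :* z :- w :* (y :* z))
           ≈-refl (a (suc j)) w (a j) (X (suc j)))) ⟩
  a 0 ⊛ X 0 ⊕ ΣS N (λ j → a (suc j) ⊛ X (suc j) ⊖ w ⊛ (a j ⊛ X (suc j)))
    ≈⟨ +-congˡ {a 0 ⊛ X 0} (ΣS-linear N w (λ j → a (suc j) ⊛ X (suc j)) (λ j → a j ⊛ X (suc j))) ⟩
  a 0 ⊛ X 0 ⊕ (ΣS N (λ j → a (suc j) ⊛ X (suc j)) ⊖ w ⊛ S₁)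
    ≈⟨ solve 3 (λ x y z → x :+ (y :- z) := (x :+ y) :- z)
         ≈-refl (a 0 ⊛ X 0) (ΣS N (λ j → a (suc j) ⊛ X (suc j))) (w ⊛ S₁) ⟩
  (a 0 ⊛ X 0 ⊕ ΣS N (λ j → a (suc j) ⊛ X (suc j))) ⊖ w ⊛ S₁
    ≈⟨ +-congʳ (≈-sym (ΣS-suc N (λ i → a i ⊛ X i))) ⟩
  ΣS N (λ i → a i ⊛ X i) ⊕ a (suc N) ⊛ X (suc N) ⊖ w ⊛ S₁
    ≈⟨ +-congʳ (+-congˡ {ΣS N (λ i → a i ⊛ X i)}
                        (≈-trans (*-congʳ {X (suc N)} a-top) (zeroˡ (X (suc N))))) ⟩
  ΣS N (λ i → a i ⊛ X i) ⊕ zeroS ⊖ w ⊛ S₁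
    ≈⟨ +-congʳ (+-identityʳ (ΣS N (λ i → a i ⊛ X i))) ⟩
  ΣS N (λ i → a i ⊛ X i) ⊖ w ⊛ S₁ ∎
  where
  open ≈-Reasoning
  S₁ : Series
  S₁ = ΣS N (λ i → a i ⊛ X (suc i))

geometric-difference : ∀ R u (F : ℤ → Series) h →
  let G = λ h → ΣS R (λ j → powS u j ⊛ F (h - + j)) in
  G h ⊖ u ⊛ G (h - 1ℤ) ≈ F h ⊖ powS u (suc R) ⊛ F (h - + suc R)
geometric-difference R u F h = begin
  ΣS R f ⊖ u ⊛ ΣS R (λ j → powS u j ⊛ F (h - 1ℤ - + j))
    ≈⟨ +-congˡ {ΣS R f} (-‿cong (≈-trans (ΣS-⊛ˡ R u (λ j → powS u j ⊛ F (h - 1ℤ - + j)))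
                                         (ΣS-cong R shift))) ⟩
  ΣS R f ⊖ ΣS R (λ j → f (suc j))
    ≈⟨ ΣS-telescope R f ⟩
  f 0 ⊖ f (suc R)
    ≈⟨ +-congʳ (≈-trans (*-identityˡ (F (h - + 0))) (≈-reflexive (cong F (ℤ.+-identityʳ h)))) ⟩
  F h ⊖ powS u (suc R) ⊛ F (h - + suc R) ∎
  where
  open ≈-Reasoning
  f : ℕ → Series
  f j = powS u j ⊛ F (h - + j)
  shift : ∀ j → u ⊛ (powS u j ⊛ F (h - 1ℤ - + j)) ≈ f (suc j)
  shift j = ≈-trans
    (solve 3 (λ u p x → u :* (p :* x) := (p :* u) :* x) ≈-refl u (powS u j) (F (h - 1ℤ - + j)))
    (*-congˡ {powS u (suc j)} (≈-reflexive (cong F (index h (+ j)))))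
    where
    index : ∀ h x → h - 1ℤ - x ≡ h - (1ℤ + x)
    index = ℤ-solve-∀

first-order-recurrence-unique : ∀ u {F G : ℤ → Series} →
  (∀ h → F h ⊖ u ⊛ F (h - 1ℤ) ≈ G h ⊖ u ⊛ G (h - 1ℤ)) → (∀ h → h <ℤ 0ℤ → F h ≈ G h) →
  ∀ n → F (+ n) ≈ G (+ n)
first-order-recurrence-unique u {F} {G} ΔF≈ΔG F≈G⁻ = unique
  where
  step : ∀ h → F (h - 1ℤ) ≈ G (h - 1ℤ) → F h ≈ G h
  step h prev = begin
    F h
      ≈⟨ solve 3 (λ x u y → x := (x :- u :* y) :+ u :* y) ≈-refl (F h) u (F (h - 1ℤ)) ⟩
    (F h ⊖ u ⊛ F (h - 1ℤ)) ⊕ u ⊛ F (h - 1ℤ)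
      ≈⟨ +-cong (ΔF≈ΔG h) (*-congˡ {u} prev) ⟩
    (G h ⊖ u ⊛ G (h - 1ℤ)) ⊕ u ⊛ G (h - 1ℤ)
      ≈⟨ solve 3 (λ x u y → (x :- u :* y) :+ u :* y := x) ≈-refl (G h) u (G (h - 1ℤ)) ⟩
    G h ∎
    where open ≈-Reasoning
  unique : ∀ n → F (+ n) ≈ G (+ n)
  unique zero = step (+ 0) (F≈G⁻ -[1+ 0 ] -<+)
  unique (suc n) = step (+ suc n) (unique n)

-- Index arithmetic

triangle : ℕ → ℕ
triangle i = i * (i ∸ 1) / 2

triangle-suc : ∀ i → triangle (suc i) ≡ i +ℕ triangle i
triangle-suc i = begin
  suc i * i / 2                  ≡⟨ /-congˡ (double i) ⟩
  (i * (i ∸ 1) +ℕ i * 2) / 2     ≡⟨ +-distrib-/-∣ʳ (i * (i ∸ 1)) (divides i refl) ⟩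
  triangle i +ℕ i * 2 / 2        ≡⟨ cong (triangle i +ℕ_) (m*n/n≡m i 2) ⟩
  triangle i +ℕ i                ≡⟨ ℕ.+-comm (triangle i) i ⟩
  i +ℕ triangle i                ∎
  where
  open ≡-Reasoning
  double : ∀ i → suc i * i ≡ i * (i ∸ 1) +ℕ i * 2
  double zero = refl
  double (suc j) = expand j
    where
    expand : ∀ j → suc (suc j) * suc j ≡ suc j * j +ℕ suc j * 2
    expand = ℕ-solve-∀

triangle-suc-+-∸ : ∀ {i s} → i ≤ s → triangle (suc i) +ℕ (s ∸ i) ≡ s +ℕ triangle i
triangle-suc-+-∸ {i} {s} i≤s = begin
  triangle (suc i) +ℕ (s ∸ i)     ≡⟨ cong (_+ℕ (s ∸ i)) (triangle-suc i) ⟩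
  i +ℕ triangle i +ℕ (s ∸ i)      ≡⟨ ℕ.+-assoc i (triangle i) (s ∸ i) ⟩
  i +ℕ (triangle i +ℕ (s ∸ i))    ≡⟨ cong (i +ℕ_) (ℕ.+-comm (triangle i) (s ∸ i)) ⟩
  i +ℕ ((s ∸ i) +ℕ triangle i)    ≡⟨ ℕ.+-assoc i (s ∸ i) (triangle i) ⟨
  i +ℕ (s ∸ i) +ℕ triangle i      ≡⟨ cong (_+ℕ triangle i) (ℕ.m+[n∸m]≡n i≤s) ⟩
  s +ℕ triangle i                 ∎
  where open ≡-Reasoning

+m-+n≡+[m∸n] : ∀ {m n} → n ≤ m → + m - + n ≡ + (m ∸ n)
+m-+n≡+[m∸n] {m} {n} n≤m = trans (ℤ.m-n≡m⊖n m n) (ℤ.⊖-≥ n≤m)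

-- r is taken to be  suc R , so that the theorem's  r ∸ 1  computes to  R .
module Summands {k R : ℕ} (1≤k : 1 ≤ k) where
  r : ℕ
  r = suc R

  private
    module Gₖ = GaussianBinomial 1≤k
    module Gᵣₖ = GaussianBinomial (ℕ.*-mono-≤ (s≤s (z≤n {R})) 1≤k)

  signedQbin : ℕ → ℕ → Series
  signedQbin s i = negOnePow i ·S mono (r * k * triangle i) ⊛ qbin (r * k) (+ s) (+ i)

  shiftedQbin : ℕ → ℤ → Series
  shiftedQbin t m = qbin k (m + + t) (+ t)

  signedQbin-zero : ∀ s → signedQbin s 0 ≈ oneS
  signedQbin-zero s = begin
    1ℤ ·S mono (r * k * 0) ⊛ qbin (r * k) (+ s) (+ 0)
      ≈⟨ *-cong (coeffwise (λ n → ℤ.*-identityˡ (mono (r * k * 0) n))) (Gᵣₖ.qbin-lower-zero s) ⟩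
    mono (r * k * 0) ⊛ oneS
      ≈⟨ ≈-trans (*-identityʳ _) (≈-reflexive (cong mono (ℕ.*-zeroʳ (r * k)))) ⟩
    oneS ∎
    where open ≈-Reasoning

  signedQbin-vanish : ∀ {s i} → s < i → signedQbin s i ≈ zeroS
  signedQbin-vanish {s} {i} s<i =
    ≈-trans (*-congˡ {sign-and-power} (Gᵣₖ.qbin-< (+<+ s<i))) (zeroʳ sign-and-power)
    where
    sign-and-power : Series
    sign-and-power = negOnePow i ·S mono (r * k * triangle i)

  signedQbin-as-⊛ : ∀ s i →
    signedQbin s i ≈ constS (negOnePow i) ⊛ mono (r * k * triangle i) ⊛ qbin (r * k) (+ s) (+ i)
  signedQbin-as-⊛ s i = *-congʳ {qbin (r * k) (+ s) (+ i)} (·S-as-⊛ (negOnePow i) (mono (r * k * triangle i)))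

  signedQbin-pascal : ∀ s i →
    signedQbin (suc s) (suc i) ≈ signedQbin s (suc i) ⊖ mono (r * k * s) ⊛ signedQbin s i
  signedQbin-pascal s i with ℕ.≤-<-connex i s
  ... | inj₁ i≤s = begin
    signedQbin (suc s) (suc i)
      ≈⟨ signedQbin-as-⊛ (suc s) (suc i) ⟩
    constS (- γ) ⊛ M′ ⊛ qbin (r * k) (+ suc s) (+ suc i)
      ≈⟨ *-cong (*-congʳ {M′} (constS-neg γ)) (Gᵣₖ.qbin-pascalʳ i≤s) ⟩
    negS c ⊛ M′ ⊛ (Q₁ ⊕ E ⊛ Q₀)
      ≈⟨ solve 5 (λ c m′ q₁ e q₀ →
             (:- c) :* m′ :* (q₁ :+ e :* q₀) := (:- c) :* m′ :* q₁ :- c :* (m′ :* e) :* q₀)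
           ≈-refl c M′ Q₁ E Q₀ ⟩
    negS c ⊛ M′ ⊛ Q₁ ⊖ c ⊛ (M′ ⊛ E) ⊛ Q₀
      ≈⟨ +-congˡ {negS c ⊛ M′ ⊛ Q₁} (-‿cong (*-congʳ {Q₀} (*-congˡ {c} exponent))) ⟩
    negS c ⊛ M′ ⊛ Q₁ ⊖ c ⊛ (W ⊛ M) ⊛ Q₀
      ≈⟨ solve 6 (λ c m′ q₁ w m q₀ →
             (:- c) :* m′ :* q₁ :- c :* (w :* m) :* q₀ := (:- c) :* m′ :* q₁ :- w :* (c :* m :* q₀))
           ≈-refl c M′ Q₁ W M Q₀ ⟩
    negS c ⊛ M′ ⊛ Q₁ ⊖ W ⊛ (c ⊛ M ⊛ Q₀)
      ≈⟨ ≈-sym (+-cong (≈-trans (signedQbin-as-⊛ s (suc i)) (*-congʳ {Q₁} (*-congʳ {M′} (constS-neg γ))))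
                       (-‿cong (*-congˡ {W} (signedQbin-as-⊛ s i)))) ⟩
    signedQbin s (suc i) ⊖ W ⊛ signedQbin s i ∎
    where
    open ≈-Reasoning
    γ : ℤ
    γ = negOnePow i
    c M′ M E W Q₁ Q₀ : Series
    c = constS γ
    M′ = mono (r * k * triangle (suc i))
    M = mono (r * k * triangle i)
    E = mono (r * k * (s ∸ i))
    W = mono (r * k * s)
    Q₁ = qbin (r * k) (+ s) (+ suc i)
    Q₀ = qbin (r * k) (+ s) (+ i)
    exponent : M′ ⊛ E ≈ W ⊛ M
    exponent = ≈-trans (mono-+ _ _) (≈-trans (≈-reflexive (cong mono exponent-sum)) (≈-sym (mono-+ _ _)))
      where
      exponent-sum : r * k * triangle (suc i) +ℕ r * k * (s ∸ i) ≡ r * k * s +ℕ r * k * triangle i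
      exponent-sum = trans (sym (ℕ.*-distribˡ-+ (r * k) _ _))
        (trans (cong (r * k *_) (triangle-suc-+-∸ i≤s)) (ℕ.*-distribˡ-+ (r * k) s (triangle i)))
  ... | inj₂ s<i = begin
    signedQbin (suc s) (suc i)
      ≈⟨ signedQbin-vanish (s≤s s<i) ⟩
    zeroS
      ≈⟨ coeffwise (λ _ → refl) ⟩
    zeroS ⊖ zeroS
      ≈⟨ +-congˡ {zeroS} (-‿cong (≈-sym (zeroʳ (mono (r * k * s))))) ⟩
    zeroS ⊖ mono (r * k * s) ⊛ zeroS
      ≈⟨ ≈-sym (+-cong (signedQbin-vanish (ℕ.m≤n⇒m≤1+n s<i))
                       (-‿cong (*-congˡ {mono (r * k * s)} (signedQbin-vanish s<i)))) ⟩
    signedQbin s (suc i) ⊖ mono (r * k * s) ⊛ signedQbin s i ∎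
    where
    open ≈-Reasoning

  shiftedQbin-vanish : ∀ t m → m <ℤ 0ℤ → shiftedQbin t m ≈ zeroS
  shiftedQbin-vanish t m m<0 = Gₖ.qbin-< (ℤ.+-monoˡ-< (+ t) m<0)

  shiftedQbin-zero : ∀ n → shiftedQbin 0 (+ n) ≈ oneS
  shiftedQbin-zero n = Gₖ.qbin-lower-zero (n +ℕ 0)

  shiftedQbin-pascal : ∀ t m →
    shiftedQbin (suc t) m ≈ shiftedQbin t m ⊕ mono (k * suc t) ⊛ shiftedQbin (suc t) (m - 1ℤ)
  shiftedQbin-pascal t (+ n) = begin
    qbin k (+ (n +ℕ suc t)) (+ suc t)
      ≡⟨ cong (λ a → qbin k (+ a) (+ suc t)) (ℕ.+-suc n t) ⟩
    qbin k (+ suc (n +ℕ t)) (+ suc t)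
      ≈⟨ Gₖ.qbin-pascalˡ (ℕ.m≤n+m t n) ⟩
    qbin k (+ (n +ℕ t)) (+ t) ⊕ mono (k * suc t) ⊛ qbin k (+ (n +ℕ t)) (+ suc t)
      ≡⟨ cong (λ A → qbin k (+ (n +ℕ t)) (+ t) ⊕ mono (k * suc t) ⊛ qbin k A (+ suc t))
              (sym (index (+ n) (+ t))) ⟩
    shiftedQbin t (+ n) ⊕ mono (k * suc t) ⊛ shiftedQbin (suc t) (+ n - 1ℤ) ∎
    where
    open ≈-Reasoning
    index : ∀ m x → m - 1ℤ + (1ℤ + x) ≡ m + x
    index = ℤ-solve-∀
  shiftedQbin-pascal t m@(-[1+ n ]) = begin
    shiftedQbin (suc t) m
      ≈⟨ shiftedQbin-vanish (suc t) m -<+ ⟩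
    zeroS
      ≈⟨ ≈-sym (+-identityʳ zeroS) ⟩
    zeroS ⊕ zeroS
      ≈⟨ +-congˡ {zeroS} (≈-sym (zeroʳ (mono (k * suc t)))) ⟩
    zeroS ⊕ mono (k * suc t) ⊛ zeroS
      ≈⟨ ≈-sym (+-cong (shiftedQbin-vanish t m -<+)
                       (*-congˡ {mono (k * suc t)} (shiftedQbin-vanish (suc t) (m - 1ℤ) -<+))) ⟩
    shiftedQbin t m ⊕ mono (k * suc t) ⊛ shiftedQbin (suc t) (m - 1ℤ) ∎
    where open ≈-Reasoning

  -- The left-hand side of the theorem for  s = t + 1 , as a function of  h .
  lhs : ℕ → ℤ → Series
  lhs t h = ΣS (suc t) (λ i → signedQbin (suc t) i ⊛ shiftedQbin t (h - + (r * i)))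

  lhs-vanish-neg : ∀ t {h} → h <ℤ 0ℤ → lhs t h ≈ zeroS
  lhs-vanish-neg t {h} h<0 = ΣS-zero (suc t) (λ i _ →
    ≈-trans (*-congˡ {signedQbin (suc t) i}
               (shiftedQbin-vanish t (h - + (r * i)) (ℤ.≤-<-trans (ℤ.i-j≤i h (+ (r * i))) h<0)))
            (zeroʳ (signedQbin (suc t) i)))

  lhs-recurrence : ∀ t h →
    lhs (suc t) h ⊖ mono (k * suc t) ⊛ lhs (suc t) (h - 1ℤ) ≈
    lhs t h ⊖ mono (r * k * suc t) ⊛ lhs t (h - + r)
  lhs-recurrence t h = begin
    ΣS (suc N) F ⊖ u ⊛ ΣS (suc N) G
      ≈⟨ ΣS-linear (suc N) u F G ⟨
    ΣS (suc N) (λ i → F i ⊖ u ⊛ G i)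
      ≈⟨ ΣS-cong (suc N) lower-t ⟩
    ΣS (suc N) (λ i → signedQbin (suc N) i ⊛ X i)
      ≈⟨ ΣS-shifted-difference N w (signedQbin N) (signedQbin (suc N)) X
           (≈-trans (signedQbin-zero (suc N)) (≈-sym (signedQbin-zero N))) (signedQbin-pascal N)
           (signedQbin-vanish (ℕ.n<1+n N)) ⟩
    ΣS N (λ i → signedQbin N i ⊛ X i) ⊖ w ⊛ ΣS N (λ i → signedQbin N i ⊛ X (suc i))
      ≈⟨ +-congˡ {lhs t h} (-‿cong (*-congˡ {w} (ΣS-cong N (λ i →
           *-congˡ {signedQbin N i} (≈-reflexive (cong (shiftedQbin t) (index i))))))) ⟩
    lhs t h ⊖ w ⊛ lhs t (h - + r) ∎
    where
    open ≈-Reasoning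
    N : ℕ
    N = suc t
    u w : Series
    u = mono (k * suc t)
    w = mono (r * k * suc t)
    F G : ℕ → Series
    F i = signedQbin (suc N) i ⊛ shiftedQbin N (h - + (r * i))
    G i = signedQbin (suc N) i ⊛ shiftedQbin N (h - 1ℤ - + (r * i))
    X : ℕ → Series
    X i = shiftedQbin t (h - + (r * i))
    lower-t : ∀ i → F i ⊖ u ⊛ G i ≈ signedQbin (suc N) i ⊛ X i
    lower-t i = begin
      F i ⊖ u ⊛ G i
        ≈⟨ +-cong (*-congˡ {a} (shiftedQbin-pascal t x))
                  (-‿cong (*-congˡ {u} (*-congˡ {a} (≈-reflexive (cong (shiftedQbin N) (swap h (+ (r * i)))))))) ⟩
      a ⊛ (X i ⊕ u ⊛ shiftedQbin N (x - 1ℤ)) ⊖ u ⊛ (a ⊛ shiftedQbin N (x - 1ℤ))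
        ≈⟨ solve 4 (λ a y u z → a :* (y :+ u :* z) :- u :* (a :* z) := a :* y)
             ≈-refl a (X i) u (shiftedQbin N (x - 1ℤ)) ⟩
      a ⊛ X i ∎
      where
      a : Series
      a = signedQbin (suc N) i
      x : ℤ
      x = h - + (r * i)
      swap : ∀ h y → h - 1ℤ - y ≡ h - y - 1ℤ
      swap = ℤ-solve-∀
    index : ∀ i → h - + (r * suc i) ≡ h - + r - + (r * i)
    index i = trans (cong (λ m → h - + m) (ℕ.*-suc r i)) (split h (+ r) (+ (r * i)))
      where
      split : ∀ h x y → h - (x + y) ≡ h - x - y
      split = ℤ-solve-∀

  lhs-suc : ∀ t n → lhs (suc t) (+ n) ≈ ΣS R (λ j → powS (mono (k * suc t)) j ⊛ lhs t (+ n - + j))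
  lhs-suc t = first-order-recurrence-unique u {lhs (suc t)} {G} Δ-agree negative-agree
    where
    u : Series
    u = mono (k * suc t)
    G : ℤ → Series
    G h = ΣS R (λ j → powS u j ⊛ lhs t (h - + j))
    Δ-agree : ∀ h → lhs (suc t) h ⊖ u ⊛ lhs (suc t) (h - 1ℤ) ≈ G h ⊖ u ⊛ G (h - 1ℤ)
    Δ-agree h = begin
      lhs (suc t) h ⊖ u ⊛ lhs (suc t) (h - 1ℤ)
        ≈⟨ lhs-recurrence t h ⟩
      lhs t h ⊖ mono (r * k * suc t) ⊛ lhs t (h - + r)
        ≈⟨ +-congˡ {lhs t h} (-‿cong (*-congʳ {lhs t (h - + r)} u^r)) ⟩
      lhs t h ⊖ powS u r ⊛ lhs t (h - + r)
        ≈⟨ geometric-difference R u (lhs t) h ⟨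
      G h ⊖ u ⊛ G (h - 1ℤ) ∎
      where
      open ≈-Reasoning
      u^r : mono (r * k * suc t) ≈ powS u r
      u^r = ≈-sym (≈-trans (powS-mono (k * suc t) r) (≈-reflexive (cong mono (reorder k (suc t) r))))
        where
        reorder : ∀ k t r → k * t * r ≡ r * k * t
        reorder = ℕ-solve-∀
    negative-agree : ∀ h → h <ℤ 0ℤ → lhs (suc t) h ≈ G h
    negative-agree h h<0 = ≈-trans (lhs-vanish-neg (suc t) h<0) (≈-sym (ΣS-zero R (λ j _ →
      ≈-trans (*-congˡ {powS u j} (lhs-vanish-neg t (ℤ.≤-<-trans (ℤ.i-j≤i h (+ j)) h<0))) (zeroʳ (powS u j)))))

  signedQbin-1-1 : signedQbin 1 1 ≈ negS oneS
  signedQbin-1-1 = begin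
    -1ℤ ·S mono (r * k * 0) ⊛ qbin (r * k) (+ 1) (+ 1)
      ≈⟨ *-cong (coeffwise (λ n → trans (ℤ.-1*i≡-i _) (cong (λ e → - mono e n) (ℕ.*-zeroʳ (r * k)))))
                (Gᵣₖ.qbin-diagonal 1) ⟩
    negS oneS ⊛ oneS
      ≈⟨ *-identityʳ (negS oneS) ⟩
    negS oneS ∎
    where open ≈-Reasoning

  lhs-vanish : ∀ t {n} → R * suc t < n → lhs t (+ n) ≈ zeroS
  lhs-vanish zero {n} R<n = begin
    signedQbin 1 0 ⊛ shiftedQbin 0 (+ n - + (r * 0)) ⊕ signedQbin 1 1 ⊛ shiftedQbin 0 (+ n - + (r * 1))
      ≈⟨ +-cong (*-cong (signedQbin-zero 1) (shiftedQbin-zero′ (subst (_≤ n) (sym (ℕ.*-zeroʳ r)) z≤n)))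
                (*-cong signedQbin-1-1 (shiftedQbin-zero′ R<n)) ⟩
    oneS ⊛ oneS ⊕ negS oneS ⊛ oneS
      ≈⟨ solve 2 (λ x y → x :* y :+ (:- x) :* y := con 0ℤ) ≈-refl oneS oneS ⟩
    zeroS ∎
    where
    open ≈-Reasoning
    shiftedQbin-zero′ : ∀ {j} → j ≤ n → shiftedQbin 0 (+ n - + j) ≈ oneS
    shiftedQbin-zero′ {j} j≤n =
      ≈-trans (≈-reflexive (cong (shiftedQbin 0) (+m-+n≡+[m∸n] j≤n))) (shiftedQbin-zero (n ∸ j))
  lhs-vanish (suc t) {n} R[t+2]<n = ≈-trans (lhs-suc t n) (ΣS-zero R (λ j j≤R →
    ≈-trans (*-congˡ {powS (mono (k * suc t)) j}
               (≈-trans (≈-reflexive (cong (lhs t) (+m-+n≡+[m∸n] (j≤n j≤R))))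
                        (lhs-vanish t (R[t+1]<n∸j j≤R))))
            (zeroʳ (powS (mono (k * suc t)) j))))
    where
    bound : R * suc t +ℕ R < n
    bound = subst (_< n) (trans (ℕ.*-suc R (suc t)) (ℕ.+-comm R (R * suc t))) R[t+2]<n
    j≤n : ∀ {j} → j ≤ R → j ≤ n
    j≤n j≤R = ℕ.≤-trans j≤R (ℕ.≤-trans (ℕ.m≤n+m R (R * suc t)) (ℕ.<⇒≤ bound))
    R[t+1]<n∸j : ∀ {j} → j ≤ R → R * suc t < n ∸ j
    R[t+1]<n∸j {j} j≤R =
      ℕ.m+n≤o⇒m≤o∸n (suc (R * suc t)) (ℕ.≤-trans (s≤s (ℕ.+-monoʳ-≤ (R * suc t) j≤R)) bound)

corollary2p3 : (k r h s : ℕ) → 1 ≤ k → 1 ≤ r → 1 ≤ s → (r ∸ 1) * s < h →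
    (n : ℕ) →
      sumTo s (λ i →
        (negOnePow i ·S mono (r * k * ((i * (i ∸ 1)) / 2))
          ⊛ qbin (r * k) (+ s) (+ i)
          ⊛ qbin k (+ h - + (r * i) + + s - 1ℤ) (+ s - 1ℤ)) n)
      ≡ 0ℤ
corollary2p3 k zero h s _ () _ _ _
corollary2p3 k (suc R) h zero _ _ () _ _
corollary2p3 k (suc R) h (suc t) 1≤k _ _ R[t+1]<h n =
  trans (sumTo-cong (suc t) (λ i → coeff (*-congˡ {signedQbin (suc t) i}
          (≈-reflexive (cong (λ m → qbin k m (+ t)) (index (+ h - + (r * i)) (+ t))))) n))
        (coeff (lhs-vanish t R[t+1]<h) n)
  where
  open Summands {k} {R} 1≤k
  index : ∀ x y → x + (1ℤ + y) - 1ℤ ≡ x + y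
  index = ℤ-solve-∀
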